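{- For any natural number $n$ and any permutation $\sigma$, $$\sum_{\pi\in S_n(\sigma)}t^{\mathrm{des}(\pi)}=\sum_{[y]\in[\mathrm{Cay}_n][\sigma^{ -1}]}t^{\log_2|[y]|}.$$
   Context: A Cayley permutation of length $n$ is a word of positive integers in which every integer from $1$ to its maximum occurs; $\mathrm{Cay}_n$ is the set of these; $\mathrm{id}_n=12\cdots n$; $\sigma^{ -1}$ is the inverse permutation. $x\ge y$ means some subsequence of $x$ is order isomorphic to $y$ (same relative order and same equalities); $S_n(\sigma)$ is the set of permutations of $[n]$ avoiding $\sigma$, and $\mathrm{des}(\pi)$ is the number of $i$ with $\pi(i)>\pi(i+1)$. For a weakly increasing Cayley permutation $u$ and a Cayley permutation $v$ of the same length, the Burge transpose $(u,v)^T$ of the biword with columns $\binom{u(i)}{v(i)}$ is obtained by turning every column upside down and then sorting the columns in increasing order of top entry, ties broken by decreasing bottom entry. For $x$ of length $n$, $\gamma(x)$ is the bottom row of $(\mathrm{id}_n,x)^T$; $x\sim y$ iff $\gamma(x)=\gamma(y)$; $[y]$ is the class of $y$ (a finite set). For classes, $[x]\ge[y]$ iff $x'\ge y'$ for some $x'\in[x]$, $y'\in[y]$. $[\mathrm{Cay}_n][\sigma^{ -1}]$ is the set of classes $[y]$ with $y\in\mathrm{Cay}_n$ and $[y]\not\ge[\sigma^{ -1}]$. -}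

module Defs where

open import Data.Nat using (ℕ; zero; suc; _+_; _^_; _<_; _≤_; _⊔_; _<ᵇ_; _≟_)
open import Data.Nat.Logarithm using (⌊log₂_⌋)
open import Data.Bool using (Bool; true; false; if_then_else_; _∨_; _∧_)
open import Data.List using (List; []; _∷_; map; length; filter; zip; upTo; foldr; reverse)
import Data.List.Properties as LP
open import Data.List.Membership.Propositional using (_∈_)
open import Data.List.Relation.Binary.Permutation.Propositional using (_↭_)
open import Data.List.Relation.Binary.Sublist.Propositional using (_⊆_)
open import Data.Product using (_×_; _,_; proj₁; proj₂; ∃-syntax)
open import Data.Unit using (⊤)
open import Data.Empty using (⊥)
open import Function.Bundles using (_⇔_)
open import Relation.Binary.PropositionalEquality using (_≡_)
open import Relation.Binary.Definitions using (DecidableEquality)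
open import Relation.Nullary using (¬_)
open import Relation.Nullary.Decidable using (⌊_⌋)

Word : Set
Word = List ℕ

_≟W_ : DecidableEquality Word
_≟W_ = LP.≡-dec _≟_

idW : ℕ → Word
idW n = map suc (upTo n)

maxW : Word → ℕ
maxW = foldr _⊔_ 0

IsCayley : Word → Set
IsCayley w = (∀ a → a ∈ w → 1 ≤ a) × (∀ k → 1 ≤ k → k ≤ maxW w → k ∈ w)

CayN : ℕ → Word → Set
CayN n w = length w ≡ n × IsCayley w

IsPerm : ℕ → Word → Set
IsPerm n w = w ↭ idW n

-- 1-based position of the first occurrence of a in w (1 + length w if absent)
posOf : ℕ → Word → ℕ
posOf a [] = 1
posOf a (b ∷ w) = if ⌊ a ≟ b ⌋ then 1 else suc (posOf a w)

inverse : Word → Word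
inverse σ = map (λ i → posOf i σ) (idW (length σ))

des : Word → ℕ
des [] = 0
des (a ∷ []) = 0
des (a ∷ b ∷ w) = (if b <ᵇ a then 1 else 0) + des (b ∷ w)

-- Order isomorphism: for all pairs of positions, same relative order and same equalities.
SameRel : ℕ → ℕ → ℕ → ℕ → Set
SameRel a a' b b' = ((a < a') ⇔ (b < b')) × ((a ≡ a') ⇔ (b ≡ b')) × ((a' < a) ⇔ (b' < b))

RelAll : ℕ → Word → ℕ → Word → Set
RelAll a [] b [] = ⊤
RelAll a (a' ∷ as) b (b' ∷ bs) = SameRel a a' b b' × RelAll a as b bs
RelAll a _ b _ = ⊥

OrderIso : Word → Word → Set
OrderIso [] [] = ⊤
OrderIso (a ∷ as) (b ∷ bs) = RelAll a as b bs × OrderIso as bs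
OrderIso _ _ = ⊥

_≽_ : Word → Word → Set
x ≽ y = ∃[ z ] (z ⊆ x × OrderIso z y)

-- Burge transpose of a biword given as a list of columns (top , bottom):
-- turn every column upside down, then sort columns by increasing top entry,
-- ties broken by decreasing bottom entry (insertion sort).
before : ℕ × ℕ → ℕ × ℕ → Bool
before (a , b) (a' , b') = (a <ᵇ a') ∨ (⌊ a ≟ a' ⌋ ∧ (b' <ᵇ b))

insertCol : ℕ × ℕ → List (ℕ × ℕ) → List (ℕ × ℕ)
insertCol c [] = c ∷ []
insertCol c (d ∷ ds) = if before c d then c ∷ d ∷ ds else d ∷ insertCol c ds

sortCols : List (ℕ × ℕ) → List (ℕ × ℕ)
sortCols = foldr insertCol []

flipCol : ℕ × ℕ → ℕ × ℕ
flipCol (a , b) = (b , a)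

burgeT : List (ℕ × ℕ) → List (ℕ × ℕ)
burgeT cols = sortCols (map flipCol cols)

-- γ(x) = bottom row of (id_n , x)^T
γ : Word → Word
γ x = map proj₂ (burgeT (zip (idW (length x)) x))

-- [x] ≥ [y] : x' ≥ y' for some Cayley permutations x' ∼ x, y' ∼ y
_≽C_ : Word → Word → Set
x ≽C y = ∃[ x' ] ∃[ y' ] (IsCayley x' × IsCayley y' × γ x' ≡ γ x × γ y' ≡ γ y × x' ≽ y')

-- |[y]| computed inside a list C enumerating Cay_n
classSize : List Word → Word → ℕ
classSize C y = length (filter (λ x → γ x ≟W γ y) C)

countClass : List Word → Word → ℕ
countClass R y = length (filter (λ r → γ r ≟W γ y) R)

module Submission where

-- γ x is the bottom row of the Burge transpose of (id , x), and [x] is the fibre of γ through x.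
-- The transpose is an involution on sorted biwords, so γ is an involution on permutations, and
-- γ σ = σ⁻¹.  Computing γ by inserting one letter at a time shows that γ depends only on the order
-- type of its argument, and that γ of a subword of x is order isomorphic to a subsequence of γ x.
-- Hence [y] avoids [σ⁻¹] iff the permutation γ y avoids σ, and γ maps a set of class
-- representatives bijectively onto S_n(σ).  Finally x is recovered from γ x and the top row v of
-- its transpose, a Cayley word whose every step is +1, or 0 at a descent of γ x; so the class of
-- y has 2 ^ des (γ y) elements.

open import Data.Bool using (true; false; if_then_else_)
open import Data.Empty using (⊥-elim)
open import Data.List using (List; []; _∷_; map; length; filter; zip; _++_; applyUpTo)
import Data.List.Properties as List
open import Data.List.Membership.Propositional using (_∈_; _∉_)
open import Data.List.Membership.Propositional.Properties
  using (∈-map⁺; ∈-map⁻; ∈-++⁺ˡ; ∈-++⁺ʳ; ∈-++⁻; ∈-filter⁺; ∈-filter⁻)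
open import Data.List.Membership.Propositional.Properties.WithK using (unique∧set⇒bag)
open import Data.List.Relation.Binary.BagAndSetEquality using (_∼[_]_; set; ∼bag⇒↭)
open import Data.List.Relation.Binary.Permutation.Propositional
  using (_↭_; refl; prep; swap; ↭-sym; ↭-trans; ↭⇒↭ₛ)
import Data.List.Relation.Binary.Permutation.Propositional.Properties as Perm
import Data.List.Relation.Binary.Permutation.Setoid.Properties as PermSetoid
open import Data.List.Relation.Binary.Disjoint.Propositional using (Disjoint)
open import Data.List.Relation.Binary.Pointwise as Pointwise using (Pointwise; []; _∷_; Pointwise-≡⇒≡)
open import Data.List.Relation.Binary.Sublist.Propositional using (_⊆_; []; _∷ʳ_; _∷_; ⊆-refl; ⊆-trans; lookup)
import Data.List.Relation.Binary.Sublist.Propositional.Properties as Sublist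
open import Data.List.Relation.Unary.All as All using (All; []; _∷_)
import Data.List.Relation.Unary.All.Properties as All
open import Data.List.Relation.Unary.AllPairs as AllPairs using (AllPairs; []; _∷_)
import Data.List.Relation.Unary.AllPairs.Properties as AllPairs
open import Data.List.Relation.Unary.Any using (here; there)
open import Data.List.Relation.Unary.Linked using (Linked; []; [-]; _∷_)
open import Data.List.Relation.Unary.Linked.Properties using (Linked⇒AllPairs)
open import Data.List.Relation.Unary.Unique.Propositional using (Unique)
import Data.List.Relation.Unary.Unique.Propositional.Properties as Unique
open import Data.Nat
open import Data.Nat.ListAction using (sum)
open import Data.Nat.ListAction.Properties using (sum-↭)
open import Data.Nat.Logarithm using (⌊log₂_⌋; ⌊log₂[2^n]⌋≡n)
open import Data.Nat.Properties
open import Data.Product using (_×_; _,_; proj₁; proj₂; ∃-syntax)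
open import Data.Sum using (_⊎_; inj₁; inj₂)
open import Data.Unit using (tt)
open import Function.Base using (_∘_; _on_)
open import Function.Bundles using (_⇔_; mk⇔; Equivalence)
open import Relation.Binary.Core using (_Preserves_⟶_)
open import Relation.Binary.Definitions using (Transitive; tri<; tri≈; tri>)
open import Relation.Binary.PropositionalEquality
  using (_≡_; _≢_; refl; sym; trans; cong; cong₂; subst; subst₂; setoid; module ≡-Reasoning)
open import Relation.Nullary using (¬_; Dec; yes; no)
open import Relation.Nullary.Decidable using (⌊_⌋)
open import Relation.Nullary.Reflects using (Reflects; ofʸ; ofⁿ; _⊎-reflects_; _×-reflects_)

open import Defs

open Equivalence using (to; from)

module _ {A : Set} {_≺_ : A → A → Set} (≺-trans : Transitive _≺_) (≺-irrefl : ∀ {x} → ¬ x ≺ x) where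

  private
    All≺⇒∉ : ∀ {x xs} → All (x ≺_) xs → x ∉ xs
    All≺⇒∉ (x≺x ∷ _) (here refl) = ≺-irrefl x≺x
    All≺⇒∉ (_ ∷ x≺xs) (there x∈xs) = All≺⇒∉ x≺xs x∈xs

    head-≡ : ∀ {x xs y ys} → All (x ≺_) xs → All (y ≺_) ys → (x ∷ xs) ∼[ set ] (y ∷ ys) → x ≡ y
    head-≡ x≺xs y≺ys eq with to eq (here refl) | from eq (here refl)
    ... | here x≡y | _ = x≡y
    ... | there _ | here y≡x = sym y≡x
    ... | there x∈ys | there y∈xs =
      ⊥-elim (≺-irrefl (≺-trans (All.lookup x≺xs y∈xs) (All.lookup y≺ys x∈ys)))

    ∈-tail : ∀ {x xs ys z} → All (x ≺_) xs → z ∈ xs → z ∈ x ∷ ys → z ∈ ys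
    ∈-tail x≺xs z∈xs (here refl) = ⊥-elim (All≺⇒∉ x≺xs z∈xs)
    ∈-tail _ _ (there z∈ys) = z∈ys

  strictlySorted-≡ : ∀ {xs ys} → AllPairs _≺_ xs → AllPairs _≺_ ys → xs ∼[ set ] ys → xs ≡ ys
  strictlySorted-≡ {[]} {[]} _ _ _ = refl
  strictlySorted-≡ {[]} {_ ∷ _} _ _ eq with () ← from eq (here refl)
  strictlySorted-≡ {_ ∷ _} {[]} _ _ eq with () ← to eq (here refl)
  strictlySorted-≡ {x ∷ xs} {y ∷ ys} (x≺xs ∷ sxs) (y≺ys ∷ sys) eq
    with refl ← head-≡ x≺xs y≺ys eq =
    cong (x ∷_) (strictlySorted-≡ sxs sys (mk⇔
      (λ z∈xs → ∈-tail x≺xs z∈xs (to eq (there z∈xs)))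
      (λ z∈ys → ∈-tail y≺ys z∈ys (from eq (there z∈ys)))))

unique-↭ : ∀ {A : Set} {xs ys : List A} → Unique xs → Unique ys → xs ∼[ set ] ys → xs ↭ ys
unique-↭ uxs uys eq = ∼bag⇒↭ (unique∧set⇒bag uxs uys eq)

Unique-resp-↭ : ∀ {A : Set} {xs ys : List A} → xs ↭ ys → Unique xs → Unique ys
Unique-resp-↭ {A} xs↭ys = PermSetoid.Unique-resp-↭ (setoid A) (↭⇒↭ₛ xs↭ys)

map⁺-injectiveOn : ∀ {A B : Set} (f : A → B) {xs} → Unique xs →
  (∀ {a b} → a ∈ xs → b ∈ xs → f a ≡ f b → a ≡ b) → Unique (map f xs)
map⁺-injectiveOn f {[]} _ _ = []
map⁺-injectiveOn f {x ∷ xs} (x∉xs ∷ uxs) inj =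
  All.tabulate fx∉ ∷ map⁺-injectiveOn f uxs (λ a∈ b∈ → inj (there a∈) (there b∈))
  where
  fx∉ : ∀ {y} → y ∈ map f xs → f x ≢ y
  fx∉ y∈ fx≡y with b , b∈xs , refl ← ∈-map⁻ f y∈ =
    All.lookup x∉xs b∈xs (inj (here refl) (there b∈xs) fx≡y)

range : ℕ → ℕ → List ℕ
range k zero = []
range k (suc n) = k ∷ range (suc k) n

idW≡range : ∀ n → idW n ≡ range 1 n
idW≡range n = go (λ i → i) 0 n (λ i → refl)
  where
  go : ∀ f k n → (∀ i → f i ≡ k + i) → map suc (applyUpTo f n) ≡ range (suc k) n
  go f k zero _ = refl
  go f k (suc n) f≗k+ =
    cong₂ _∷_ (cong suc (trans (f≗k+ 0) (+-identityʳ k)))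
      (go (f ∘ suc) (suc k) n (λ i → trans (f≗k+ (suc i)) (+-suc k i)))

length-range : ∀ k n → length (range k n) ≡ n
length-range k zero = refl
length-range k (suc n) = cong suc (length-range (suc k) n)

length-idW : ∀ n → length (idW n) ≡ n
length-idW n = trans (cong length (idW≡range n)) (length-range 1 n)

∈-range⁻ : ∀ {k n i} → i ∈ range k n → k ≤ i × i < k + n
∈-range⁻ {k} {suc n} (here refl) = ≤-refl , m<m+n k z<s
∈-range⁻ {k} {suc n} {i} (there i∈) with k<i , i<k+n ← ∈-range⁻ i∈ =
  <⇒≤ k<i , subst (i <_) (sym (+-suc k n)) i<k+n

∈-range⁺ : ∀ {k n i} → k ≤ i → i < k + n → i ∈ range k n
∈-range⁺ {k} {zero} k≤i i<k = ⊥-elim (<-irrefl refl (≤-trans i<k (subst (_≤ _) (sym (+-identityʳ k)) k≤i)))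
∈-range⁺ {k} {suc n} {i} k≤i i<k+n with k ≟ i
... | yes refl = here refl
... | no k≢i = there (∈-range⁺ (≤∧≢⇒< k≤i k≢i) (subst (i <_) (+-suc k n) i<k+n))

range-strictlySorted : ∀ k n → AllPairs _<_ (range k n)
range-strictlySorted k zero = []
range-strictlySorted k (suc n) = All.tabulate (proj₁ ∘ ∈-range⁻) ∷ range-strictlySorted (suc k) n

idW-strictlySorted : ∀ n → AllPairs _<_ (idW n)
idW-strictlySorted n = subst (AllPairs _<_) (sym (idW≡range n)) (range-strictlySorted 1 n)

idW-unique : ∀ n → Unique (idW n)
idW-unique n = AllPairs.map (λ i<j i≡j → <-irrefl i≡j i<j) (idW-strictlySorted n)

maxW-↭ : ∀ {xs ys} → xs ↭ ys → maxW xs ≡ maxW ys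
maxW-↭ xs↭ys = PermSetoid.foldr-commMonoid (setoid ℕ) ⊔-0-isCommutativeMonoid (↭⇒↭ₛ xs↭ys)

maxW≤ : ∀ {m xs} → All (_≤ m) xs → maxW xs ≤ m
maxW≤ [] = z≤n
maxW≤ (x≤m ∷ xs≤m) = ⊔-lub x≤m (maxW≤ xs≤m)

IsCayley-resp-↭ : ∀ {xs ys} → xs ↭ ys → IsCayley xs → IsCayley ys
IsCayley-resp-↭ xs↭ys (positive , covers) =
  (λ a a∈ys → positive a (Perm.∈-resp-↭ (↭-sym xs↭ys) a∈ys)) ,
  (λ k 1≤k k≤max → Perm.∈-resp-↭ xs↭ys (covers k 1≤k (subst (k ≤_) (sym (maxW-↭ xs↭ys)) k≤max)))

idW-IsCayley : ∀ n → IsCayley (idW n)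
idW-IsCayley n rewrite idW≡range n =
  (λ a a∈ → proj₁ (∈-range⁻ a∈)) ,
  (λ k 1≤k k≤max → ∈-range⁺ 1≤k (s≤s (≤-trans k≤max maxW≤n)))
  where
  maxW≤n : maxW (range 1 n) ≤ n
  maxW≤n = maxW≤ (All.tabulate (≤-pred ∘ proj₂ ∘ ∈-range⁻ {1} {n}))

IsPerm⇒IsCayley : ∀ {n π} → IsPerm n π → IsCayley π
IsPerm⇒IsCayley {n} π↭id = IsCayley-resp-↭ (↭-sym π↭id) (idW-IsCayley n)

IsPerm⇒Unique : ∀ {n π} → IsPerm n π → Unique π
IsPerm⇒Unique {n} π↭id = Unique-resp-↭ (↭-sym π↭id) (idW-unique n)

IsPerm⇒length : ∀ {n π} → IsPerm n π → length π ≡ n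
IsPerm⇒length {n} π↭id = trans (Perm.↭-length π↭id) (length-idW n)

Col : Set
Col = ℕ × ℕ

_≺_ : Col → Col → Set
(a , i) ≺ (b , j) = a < b ⊎ (a ≡ b × j < i)

Sorted : List Col → Set
Sorted = AllPairs _≺_

≺-trans : Transitive _≺_
≺-trans (inj₁ a<b) (inj₁ b<c) = inj₁ (<-trans a<b b<c)
≺-trans (inj₁ a<b) (inj₂ (refl , _)) = inj₁ a<b
≺-trans (inj₂ (refl , _)) (inj₁ b<c) = inj₁ b<c
≺-trans (inj₂ (refl , j<i)) (inj₂ (refl , k<j)) = inj₂ (refl , <-trans k<j j<i)

≺-irrefl : ∀ {p} → ¬ p ≺ p
≺-irrefl (inj₁ a<a) = <-irrefl refl a<a
≺-irrefl (inj₂ (_ , i<i)) = <-irrefl refl i<i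

≺-connex : ∀ p q → p ≢ q → ¬ p ≺ q → q ≺ p
≺-connex (a , i) (b , j) p≢q p⊀q with <-cmp a b
... | tri< a<b _ _ = ⊥-elim (p⊀q (inj₁ a<b))
... | tri> _ _ b<a = inj₁ b<a
... | tri≈ _ refl _ with <-cmp i j
...   | tri< i<j _ _ = inj₂ (refl , i<j)
...   | tri≈ _ refl _ = ⊥-elim (p≢q refl)
...   | tri> _ _ j<i = ⊥-elim (p⊀q (inj₂ (refl , j<i)))

≺⇒≤ : ∀ {p q} → p ≺ q → proj₁ p ≤ proj₁ q
≺⇒≤ (inj₁ a<b) = <⇒≤ a<b
≺⇒≤ (inj₂ (refl , _)) = ≤-refl

Sorted⇒Unique : ∀ {L} → Sorted L → Unique L
Sorted⇒Unique = AllPairs.map (λ p≺q p≡q → ≺-irrefl (subst (_ ≺_) (sym p≡q) p≺q))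

≟-reflects-≡ : ∀ a b → Reflects (a ≡ b) ⌊ a ≟ b ⌋
≟-reflects-≡ a b with a ≟ b
... | yes a≡b = ofʸ a≡b
... | no a≢b = ofⁿ a≢b

before-reflects-≺ : ∀ p q → Reflects (p ≺ q) (before p q)
before-reflects-≺ (a , i) (b , j) = <ᵇ-reflects-< a b ⊎-reflects (≟-reflects-≡ a b ×-reflects <ᵇ-reflects-< j i)

insertCol-↭ : ∀ c L → insertCol c L ↭ c ∷ L
insertCol-↭ c [] = refl
insertCol-↭ c (d ∷ L) with before c d
... | true = refl
... | false = ↭-trans (prep d (insertCol-↭ c L)) (swap d c refl)

sortCols-↭ : ∀ L → sortCols L ↭ L
sortCols-↭ [] = refl
sortCols-↭ (c ∷ L) = ↭-trans (insertCol-↭ c (sortCols L)) (prep c (sortCols-↭ L))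

insertCol-sorted : ∀ {c L} → All (c ≢_) L → Sorted L → Sorted (insertCol c L)
insertCol-sorted {c} {[]} _ _ = [] ∷ []
insertCol-sorted {c} {d ∷ L} (c≢d ∷ c∉L) (d≺L ∷ sL) with before c d | before-reflects-≺ c d
... | true | ofʸ c≺d = (c≺d ∷ All.map (≺-trans c≺d) d≺L) ∷ d≺L ∷ sL
... | false | ofⁿ c⊀d =
  Perm.All-resp-↭ (↭-sym (insertCol-↭ c L)) (≺-connex c d c≢d c⊀d ∷ d≺L) ∷ insertCol-sorted c∉L sL

sortCols-sorted : ∀ {L} → Unique L → Sorted (sortCols L)
sortCols-sorted [] = []
sortCols-sorted {c ∷ L} (c∉L ∷ uL) =
  insertCol-sorted (Perm.All-resp-↭ (↭-sym (sortCols-↭ L)) c∉L) (sortCols-sorted uL)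

map-flipCol-involutive : ∀ L → map flipCol (map flipCol L) ≡ L
map-flipCol-involutive [] = refl
map-flipCol-involutive (p ∷ L) = cong (p ∷_) (map-flipCol-involutive L)

burgeT-↭ : ∀ L → burgeT L ↭ map flipCol L
burgeT-↭ L = sortCols-↭ (map flipCol L)

burgeT-sorted : ∀ {L} → Unique L → Sorted (burgeT L)
burgeT-sorted uL = sortCols-sorted (Unique.map⁺ (cong flipCol) uL)

↭⇒∼set : ∀ {A : Set} {xs ys : List A} → xs ↭ ys → xs ∼[ set ] ys
↭⇒∼set xs↭ys = mk⇔ (Perm.∈-resp-↭ xs↭ys) (Perm.∈-resp-↭ (↭-sym xs↭ys))

burgeT-unique : ∀ {L M} → Unique L → Sorted M → M ∼[ set ] map flipCol L → burgeT L ≡ M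
burgeT-unique {L} uL sM M≈ = strictlySorted-≡ ≺-trans ≺-irrefl (burgeT-sorted uL) sM
  (mk⇔ (from M≈ ∘ to (↭⇒∼set (burgeT-↭ L))) (from (↭⇒∼set (burgeT-↭ L)) ∘ to M≈))

burgeT-involutive : ∀ {L} → Sorted L → burgeT (burgeT L) ≡ L
burgeT-involutive {L} sL = burgeT-unique (Sorted⇒Unique (burgeT-sorted (Sorted⇒Unique sL))) sL
  (↭⇒∼set (subst (_↭ map flipCol (burgeT L)) (map-flipCol-involutive L)
    (↭-sym (Perm.map⁺ flipCol (burgeT-↭ L)))))

map-proj₁-zip : ∀ {xs ys : List ℕ} → length xs ≡ length ys → map proj₁ (zip xs ys) ≡ xs
map-proj₁-zip {[]} {[]} _ = refl
map-proj₁-zip {x ∷ xs} {y ∷ ys} eq = cong (x ∷_) (map-proj₁-zip (suc-injective eq))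

map-proj₂-zip : ∀ {xs ys : List ℕ} → length xs ≡ length ys → map proj₂ (zip xs ys) ≡ ys
map-proj₂-zip {[]} {[]} _ = refl
map-proj₂-zip {x ∷ xs} {y ∷ ys} eq = cong (y ∷_) (map-proj₂-zip (suc-injective eq))

zip-map-proj : ∀ (L : List Col) → zip (map proj₁ L) (map proj₂ L) ≡ L
zip-map-proj [] = refl
zip-map-proj (p ∷ L) = cong (p ∷_) (zip-map-proj L)

map-proj₂-flipCol : ∀ L → map proj₂ (map flipCol L) ≡ map proj₁ L
map-proj₂-flipCol L = sym (List.map-∘ L)

map-proj₁-flipCol : ∀ L → map proj₁ (map flipCol L) ≡ map proj₂ L
map-proj₁-flipCol L = sym (List.map-∘ L)

biword : Word → List Col
biword x = zip (idW (length x)) x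

map-proj₂-biword : ∀ x → map proj₂ (biword x) ≡ x
map-proj₂-biword x = map-proj₂-zip (length-idW (length x))

biword-sorted : ∀ x → Sorted (biword x)
biword-sorted x = subst (λ l → Sorted (zip l x)) (sym (idW≡range (length x))) (zip-range-sorted 1 x)
  where
  ∈-zip⇒∈ : ∀ {xs ys : List ℕ} {p} → p ∈ zip xs ys → proj₁ p ∈ xs
  ∈-zip⇒∈ {_ ∷ _} {_ ∷ _} (here refl) = here refl
  ∈-zip⇒∈ {_ ∷ _} {_ ∷ _} (there p∈) = there (∈-zip⇒∈ p∈)
  zip-range-sorted : ∀ k x → Sorted (zip (range k (length x)) x)
  zip-range-sorted k [] = []
  zip-range-sorted k (a ∷ x) =
    All.tabulate (λ p∈ → inj₁ (proj₁ (∈-range⁻ (∈-zip⇒∈ p∈)))) ∷ zip-range-sorted (suc k) x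

burgeT-biword-sorted : ∀ x → Sorted (burgeT (biword x))
burgeT-biword-sorted x = burgeT-sorted (Sorted⇒Unique (biword-sorted x))

γ-IsPerm : ∀ x → IsPerm (length x) (γ x)
γ-IsPerm x = subst (γ x ↭_) (trans (map-proj₂-flipCol (biword x)) (map-proj₁-zip (length-idW (length x))))
  (Perm.map⁺ proj₂ (burgeT-↭ (biword x)))

length-γ : ∀ x → length (γ x) ≡ length x
length-γ x = IsPerm⇒length (γ-IsPerm x)

γ-CayN : ∀ {n π} → IsPerm n π → CayN n (γ π)
γ-CayN {π = π} π↭id = trans (length-γ π) (IsPerm⇒length π↭id) , IsPerm⇒IsCayley (γ-IsPerm π)

burgeT-topRow : ∀ {n L} → IsPerm n (map proj₂ L) → map proj₁ (burgeT L) ≡ idW n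
burgeT-topRow {n} {L} L₂↭id = strictlySorted-≡ <-trans (<-irrefl refl)
    (AllPairs.map⁺ (AllPairs.zipWith ≺-without-ties (burgeT-sorted uL , AllPairs.map⁻ uT₁)))
    (idW-strictlySorted n) (↭⇒∼set T₁↭id)
  where
  uL : Unique L
  uL = Unique.map⁻ (IsPerm⇒Unique L₂↭id)
  T₁↭id : map proj₁ (burgeT L) ↭ idW n
  T₁↭id = ↭-trans (subst (map proj₁ (burgeT L) ↭_) (map-proj₁-flipCol L) (Perm.map⁺ proj₁ (burgeT-↭ L)))
            L₂↭id
  uT₁ : Unique (map proj₁ (burgeT L))
  uT₁ = Unique-resp-↭ (↭-sym T₁↭id) (idW-unique n)
  ≺-without-ties : ∀ {p q} → p ≺ q × proj₁ p ≢ proj₁ q → proj₁ p < proj₁ q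
  ≺-without-ties (inj₁ a<b , _) = a<b
  ≺-without-ties (inj₂ (a≡b , _) , a≢b) = ⊥-elim (a≢b a≡b)

burgeT≡biword : ∀ {n L} → IsPerm n (map proj₂ L) → burgeT L ≡ biword (map proj₂ (burgeT L))
burgeT≡biword {n} {L} L₂↭id = begin
  burgeT L                                            ≡⟨ zip-map-proj (burgeT L) ⟨
  zip (map proj₁ (burgeT L)) (map proj₂ (burgeT L))   ≡⟨ cong (λ l → zip l _) (burgeT-topRow L₂↭id) ⟩
  zip (idW n) (map proj₂ (burgeT L))                  ≡⟨ cong (λ m → zip (idW m) _) length≡ ⟨
  biword (map proj₂ (burgeT L))                       ∎
  where
  open ≡-Reasoning
  length≡ : length (map proj₂ (burgeT L)) ≡ n
  length≡ = trans (List.length-map proj₂ (burgeT L)) (trans (Perm.↭-length (burgeT-↭ L))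
    (trans (List.length-map flipCol L) (trans (sym (List.length-map proj₂ L)) (IsPerm⇒length L₂↭id))))

γ-involutive : ∀ {n π} → IsPerm n π → γ (γ π) ≡ π
γ-involutive {n} {π} π↭id = begin
  map proj₂ (burgeT (biword (γ π)))       ≡⟨ cong (map proj₂ ∘ burgeT) (burgeT≡biword (π↭id′)) ⟨
  map proj₂ (burgeT (burgeT (biword π)))  ≡⟨ cong (map proj₂) (burgeT-involutive (biword-sorted π)) ⟩
  map proj₂ (biword π)                    ≡⟨ map-proj₂-biword π ⟩
  π                                       ∎
  where
  open ≡-Reasoning
  π↭id′ : IsPerm n (map proj₂ (biword π))
  π↭id′ = subst (IsPerm n) (sym (map-proj₂-biword π)) π↭id

topRow : Word → Word
topRow x = map proj₁ (burgeT (biword x))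

topRow-↭ : ∀ x → topRow x ↭ x
topRow-↭ x = subst (topRow x ↭_) (trans (map-proj₁-flipCol (biword x)) (map-proj₂-biword x))
  (Perm.map⁺ proj₁ (burgeT-↭ (biword x)))

-- Inverts x ↦ (topRow x , γ x): the Burge transpose is an involution on sorted biwords.
unγ : Word → Word → Word
unγ v π = map proj₂ (burgeT (zip v π))

unγ-topRow-γ : ∀ x → unγ (topRow x) (γ x) ≡ x
unγ-topRow-γ x = begin
  map proj₂ (burgeT (zip (topRow x) (γ x)))   ≡⟨ cong (map proj₂ ∘ burgeT) (zip-map-proj (burgeT (biword x))) ⟩
  map proj₂ (burgeT (burgeT (biword x)))      ≡⟨ cong (map proj₂) (burgeT-involutive (biword-sorted x)) ⟩
  map proj₂ (biword x)                        ≡⟨ map-proj₂-biword x ⟩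
  x                                           ∎
  where open ≡-Reasoning

module _ {n π v} (π↭id : IsPerm n π) (|v|≡n : length v ≡ n) (v,π-sorted : Sorted (zip v π)) where

  private
    |v|≡|π| : length v ≡ length π
    |v|≡|π| = trans |v|≡n (sym (IsPerm⇒length π↭id))

  burgeT-biword-unγ : burgeT (biword (unγ v π)) ≡ zip v π
  burgeT-biword-unγ = begin
    burgeT (biword (unγ v π))    ≡⟨ cong burgeT (burgeT≡biword {L = zip v π} π↭id′) ⟨
    burgeT (burgeT (zip v π))    ≡⟨ burgeT-involutive v,π-sorted ⟩
    zip v π                      ∎
    where
    open ≡-Reasoning
    π↭id′ : IsPerm n (map proj₂ (zip v π))
    π↭id′ = subst (IsPerm n) (sym (map-proj₂-zip |v|≡|π|)) π↭id

  γ-unγ : γ (unγ v π) ≡ π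
  γ-unγ = trans (cong (map proj₂) burgeT-biword-unγ) (map-proj₂-zip |v|≡|π|)

  topRow-unγ : topRow (unγ v π) ≡ v
  topRow-unγ = trans (cong (map proj₁) burgeT-biword-unγ) (map-proj₁-zip |v|≡|π|)

  unγ-↭ : unγ v π ↭ v
  unγ-↭ = subst (unγ v π ↭_) topRow-unγ (↭-sym (topRow-↭ (unγ v π)))

  length-unγ : length (unγ v π) ≡ n
  length-unγ = trans (Perm.↭-length unγ-↭) |v|≡n

-- The biword (range k (length z) , z) with its columns turned upside down.
columns : ℕ → Word → List Col
columns k [] = []
columns k (a ∷ z) = (a , k) ∷ columns (suc k) z

shift : Col → Col
shift (a , i) = a , suc i

columns-suc : ∀ k z → columns (suc k) z ≡ map shift (columns k z)
columns-suc k [] = refl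
columns-suc k (a ∷ z) = cong ((a , suc k) ∷_) (columns-suc (suc k) z)

flip-biword : ∀ z → map flipCol (biword z) ≡ columns 1 z
flip-biword z = trans (cong (λ l → map flipCol (zip l z)) (idW≡range (length z))) (flip-zip-range 1 z)
  where
  flip-zip-range : ∀ k z → map flipCol (zip (range k (length z)) z) ≡ columns k z
  flip-zip-range k [] = refl
  flip-zip-range k (a ∷ z) = cong ((a , k) ∷_) (flip-zip-range (suc k) z)

columns-position≥ : ∀ {k z p} → p ∈ columns k z → k ≤ proj₂ p
columns-position≥ {z = _ ∷ _} (here refl) = ≤-refl
columns-position≥ {z = _ ∷ _} (there p∈) = <⇒≤ (columns-position≥ p∈)

∈-columns⇒∈ : ∀ {k z p} → p ∈ columns k z → proj₁ p ∈ z
∈-columns⇒∈ {z = _ ∷ _} (here refl) = here refl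
∈-columns⇒∈ {z = _ ∷ _} (there p∈) = there (∈-columns⇒∈ p∈)

posOf-∈-columns : ∀ k {σ i} → i ∈ σ → (i , k + posOf i σ) ∈ columns (suc k) σ
posOf-∈-columns k {b ∷ σ} {i} i∈ with i ≟ b
... | yes refl = here (cong (i ,_) (+-comm k 1))
... | no i≢b with i∈
...   | here i≡b = ⊥-elim (i≢b i≡b)
...   | there i∈σ =
  there (subst (λ j → (i , j) ∈ columns (suc (suc k)) σ) (sym (+-suc k (posOf i σ)))
    (posOf-∈-columns (suc k) i∈σ))

∈-columns⇒posOf : ∀ k {σ c j} → Unique σ → (c , j) ∈ columns (suc k) σ → j ≡ k + posOf c σ
∈-columns⇒posOf k {b ∷ σ} {c} _ (here refl) with c ≟ c
... | yes _ = +-comm 1 k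
... | no c≢c = ⊥-elim (c≢c refl)
∈-columns⇒posOf k {b ∷ σ} {c} (b∉σ ∷ uσ) (there c,j∈) with c ≟ b
... | yes refl = ⊥-elim (All.lookup b∉σ (∈-columns⇒∈ c,j∈) refl)
... | no _ = trans (∈-columns⇒posOf (suc k) uσ c,j∈) (sym (+-suc k (posOf c σ)))

inverse≡γ : ∀ {k σ} → IsPerm k σ → inverse σ ≡ γ σ
inverse≡γ {k} {σ} σ↭id = begin
  map (λ i → posOf i σ) (idW (length σ))  ≡⟨ List.map-∘ (idW (length σ)) ⟩
  map proj₂ positions                      ≡⟨ cong (map proj₂) burgeT≡positions ⟨
  γ σ                                      ∎
  where
  open ≡-Reasoning
  positions : List Col
  positions = map (λ i → i , posOf i σ) (idW (length σ))
  ∈-idW⇔∈ : ∀ {i} → i ∈ idW (length σ) ⇔ i ∈ σ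
  ∈-idW⇔∈ = subst (λ m → ∀ {i} → i ∈ idW m ⇔ i ∈ σ) (sym (IsPerm⇒length σ↭id)) (↭⇒∼set (↭-sym σ↭id))
  positions-sorted : Sorted positions
  positions-sorted = AllPairs.map⁺ (AllPairs.map inj₁ (idW-strictlySorted (length σ)))
  position∈columns : ∀ {p} → p ∈ positions → p ∈ columns 1 σ
  position∈columns p∈ with i , i∈ , refl ← ∈-map⁻ _ p∈ = posOf-∈-columns 0 (to ∈-idW⇔∈ i∈)
  column∈positions : ∀ {p} → p ∈ columns 1 σ → p ∈ positions
  column∈positions {c , j} c,j∈ =
    subst (λ j → (c , j) ∈ positions) (sym (∈-columns⇒posOf 0 (IsPerm⇒Unique σ↭id) c,j∈))
      (∈-map⁺ _ (from ∈-idW⇔∈ (∈-columns⇒∈ c,j∈)))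
  burgeT≡positions : burgeT (biword σ) ≡ positions
  burgeT≡positions = burgeT-unique (Sorted⇒Unique (biword-sorted σ)) positions-sorted
    (subst (positions ∼[ set ]_) (sym (flip-biword σ)) (mk⇔ position∈columns column∈positions))

sortCols-shift : ∀ L → sortCols (map shift L) ≡ map shift (sortCols L)
sortCols-shift [] = refl
sortCols-shift (c ∷ L) = trans (cong (insertCol (shift c)) (sortCols-shift L)) (insertCol-shift (sortCols L))
  where
  insertCol-shift : ∀ L → insertCol (shift c) (map shift L) ≡ map shift (insertCol c L)
  insertCol-shift [] = refl
  insertCol-shift (d ∷ L) with before c d
  ... | true = refl
  ... | false = cong (shift d ∷_) (insertCol-shift L)

insertNew : ℕ → List Col → List Col
insertNew a [] = (a , 1) ∷ []
insertNew a (d ∷ L) = if a <ᵇ proj₁ d then (a , 1) ∷ d ∷ L else d ∷ insertNew a L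

insertCol-new : ∀ a L → insertCol (a , 1) (map shift L) ≡ insertNew a (map shift L)
insertCol-new a [] = refl
insertCol-new a ((b , j) ∷ L) with a <ᵇ b | a ≟ b
... | true | _ = refl
... | false | yes _ = cong ((b , suc j) ∷_) (insertCol-new a L)
... | false | no _ = cong ((b , suc j) ∷_) (insertCol-new a L)

-- sortCols (columns 1 z), built by inserting the first column into the sorted tail: its
-- position 1 is the smallest, so it goes after every column of equal value.
burge : Word → List Col
burge [] = []
burge (a ∷ z) = insertNew a (map shift (burge z))

sortCols-columns : ∀ z → sortCols (columns 1 z) ≡ burge z
sortCols-columns [] = refl
sortCols-columns (a ∷ z) = begin
  insertCol (a , 1) (sortCols (columns 2 z))          ≡⟨ cong (insertCol (a , 1) ∘ sortCols) (columns-suc 1 z) ⟩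
  insertCol (a , 1) (sortCols (map shift (columns 1 z))) ≡⟨ cong (insertCol (a , 1)) (sortCols-shift (columns 1 z)) ⟩
  insertCol (a , 1) (map shift (sortCols (columns 1 z))) ≡⟨ cong (insertCol (a , 1) ∘ map shift) (sortCols-columns z) ⟩
  insertCol (a , 1) (map shift (burge z))              ≡⟨ insertCol-new a (burge z) ⟩
  insertNew a (map shift (burge z))                    ∎
  where open ≡-Reasoning

burgeT-biword≡burge : ∀ z → burgeT (biword z) ≡ burge z
burgeT-biword≡burge z = trans (cong sortCols (flip-biword z)) (sortCols-columns z)

γ≡burge : ∀ z → γ z ≡ map proj₂ (burge z)
γ≡burge z = cong (map proj₂) (burgeT-biword≡burge z)

burge-sorted : ∀ z → Sorted (burge z)
burge-sorted z = subst Sorted (burgeT-biword≡burge z) (burgeT-biword-sorted z)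

burge-↭ : ∀ z → burge z ↭ columns 1 z
burge-↭ z = subst₂ _↭_ (burgeT-biword≡burge z) (flip-biword z) (burgeT-↭ (biword z))

∈-burge⇒∈-columns : ∀ {z p} → p ∈ burge z → p ∈ columns 1 z
∈-burge⇒∈-columns {z} = Perm.∈-resp-↭ (burge-↭ z)

≺-shift : ∀ {p q} → p ≺ q → shift p ≺ shift q
≺-shift (inj₁ a<b) = inj₁ a<b
≺-shift (inj₂ (a≡b , j<i)) = inj₂ (a≡b , s≤s j<i)

-- Patterns

SamePositions : List Col → List Col → Set
SamePositions = Pointwise (_≡_ on proj₂)

insertNew-samePositions : ∀ a b {L M} → SamePositions L M →
  (∀ {p q} → p ∈ L → q ∈ M → proj₂ p ≡ proj₂ q → (a < proj₁ p ⇔ b < proj₁ q)) →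
  SamePositions (insertNew a L) (insertNew b M)
insertNew-samePositions a b [] _ = refl ∷ []
insertNew-samePositions a b {d ∷ L} {e ∷ M} (d~e ∷ L~M) sameOrder
  with a <ᵇ proj₁ d | <ᵇ-reflects-< a (proj₁ d) | b <ᵇ proj₁ e | <ᵇ-reflects-< b (proj₁ e)
... | true | _ | true | _ = refl ∷ d~e ∷ L~M
... | false | _ | false | _ = d~e ∷ insertNew-samePositions a b L~M (λ p∈ q∈ → sameOrder (there p∈) (there q∈))
... | true | ofʸ a<d | false | ofⁿ b≮e = ⊥-elim (b≮e (to (sameOrder (here refl) (here refl) d~e) a<d))
... | false | ofⁿ a≮d | true | ofʸ b<e = ⊥-elim (a≮d (from (sameOrder (here refl) (here refl) d~e) b<e))

RelAll-columns : ∀ {a z b w k p q} → RelAll a z b w → p ∈ columns k z → q ∈ columns k w →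
  proj₂ p ≡ proj₂ q → SameRel a (proj₁ p) b (proj₁ q)
RelAll-columns {z = _ ∷ _} {w = _ ∷ _} (same , _) (here refl) (here refl) _ = same
RelAll-columns {z = _ ∷ _} {w = _ ∷ _} _ (here refl) (there q∈) k≡ =
  ⊥-elim (<-irrefl k≡ (columns-position≥ q∈))
RelAll-columns {z = _ ∷ _} {w = _ ∷ _} _ (there p∈) (here refl) ≡k =
  ⊥-elim (<-irrefl (sym ≡k) (columns-position≥ p∈))
RelAll-columns {z = _ ∷ _} {w = _ ∷ _} (_ , rel) (there p∈) (there q∈) eq = RelAll-columns rel p∈ q∈ eq

burge-orderIso : ∀ z w → OrderIso z w → SamePositions (burge z) (burge w)
burge-orderIso [] [] _ = []
burge-orderIso (a ∷ z) (b ∷ w) (rel , iso) =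
  insertNew-samePositions a b (Pointwise.map⁺ shift shift (Pointwise.map (cong suc) (burge-orderIso z w iso)))
    (λ p∈ q∈ eq → proj₁ (RelAll-columns rel (∈-shifted p∈) (∈-shifted q∈) eq))
  where
  ∈-shifted : ∀ {z p} → p ∈ map shift (burge z) → p ∈ columns 2 z
  ∈-shifted {z} p∈ = subst (_ ∈_) (sym (columns-suc 1 z)) (Perm.∈-resp-↭ (Perm.map⁺ shift (burge-↭ z)) p∈)

orderIso⇒γ≡ : ∀ {z w} → OrderIso z w → γ z ≡ γ w
orderIso⇒γ≡ {z} {w} iso = begin
  γ z                     ≡⟨ γ≡burge z ⟩
  map proj₂ (burge z)     ≡⟨ Pointwise-≡⇒≡ (Pointwise.map⁺ proj₂ proj₂ (burge-orderIso z w iso)) ⟩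
  map proj₂ (burge w)     ≡⟨ γ≡burge w ⟨
  γ w                     ∎
  where open ≡-Reasoning

module _ {e : ℕ → ℕ} (e-mono : e Preserves _<_ ⟶ _<_) where

  strictlyMonotone-reflects-< : ∀ {i j} → e i < e j → i < j
  strictlyMonotone-reflects-< {i} {j} ei<ej with <-cmp i j
  ... | tri< i<j _ _ = i<j
  ... | tri≈ _ refl _ = ⊥-elim (<-irrefl refl ei<ej)
  ... | tri> _ _ j<i = ⊥-elim (<-asym ei<ej (e-mono j<i))

  strictlyMonotone-injective : ∀ {i j} → e i ≡ e j → i ≡ j
  strictlyMonotone-injective {i} {j} ei≡ej with <-cmp i j
  ... | tri< i<j _ _ = ⊥-elim (<-irrefl ei≡ej (e-mono i<j))
  ... | tri≈ _ i≡j _ = i≡j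
  ... | tri> _ _ j<i = ⊥-elim (<-irrefl (sym ei≡ej) (e-mono j<i))

  strictlyMonotone-SameRel : ∀ i j → SameRel (e i) (e j) i j
  strictlyMonotone-SameRel i j =
    mk⇔ strictlyMonotone-reflects-< e-mono ,
    mk⇔ strictlyMonotone-injective (cong e) ,
    mk⇔ strictlyMonotone-reflects-< e-mono

  map-strictlyMonotone-orderIso : ∀ u → OrderIso (map e u) u
  map-strictlyMonotone-orderIso [] = tt
  map-strictlyMonotone-orderIso (i ∷ u) = relAll u , map-strictlyMonotone-orderIso u
    where
    relAll : ∀ u → RelAll (e i) (map e u) i u
    relAll [] = tt
    relAll (j ∷ u) = strictlyMonotone-SameRel i j , relAll u

lift : (ℕ → ℕ) → ℕ → ℕ
lift e zero = zero
lift e (suc i) = suc (e i)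

lift-strictlyMonotone : ∀ {e} → e Preserves _<_ ⟶ _<_ → lift e Preserves _<_ ⟶ _<_
lift-strictlyMonotone e-mono {zero} {suc j} _ = z<s
lift-strictlyMonotone e-mono {suc i} {suc j} (s≤s i<j) = s≤s (e-mono i<j)

relabel : (ℕ → ℕ) → Col → Col
relabel e (a , i) = a , e i

relabel-lift-shift : ∀ e L → map (relabel (lift e)) (map shift L) ≡ map shift (map (relabel e) L)
relabel-lift-shift e [] = refl
relabel-lift-shift e (p ∷ L) = cong (shift (relabel e p) ∷_) (relabel-lift-shift e L)

relabel-insertNew : ∀ {e} a L → e 1 ≡ 1 → map (relabel e) (insertNew a L) ≡ insertNew a (map (relabel e) L)
relabel-insertNew a [] e1≡1 = cong (λ i → (a , i) ∷ []) e1≡1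
relabel-insertNew {e} a (d ∷ L) e1≡1 with a <ᵇ proj₁ d
... | true = cong (λ i → (a , i) ∷ relabel e d ∷ map (relabel e) L) e1≡1
... | false = cong (relabel e d ∷_) (relabel-insertNew a L e1≡1)

⊆-insertNew : ∀ a L → L ⊆ insertNew a L
⊆-insertNew a [] = (a , 1) ∷ʳ []
⊆-insertNew a (d ∷ L) with a <ᵇ proj₁ d
... | true = (a , 1) ∷ʳ ⊆-refl
... | false = refl ∷ ⊆-insertNew a L

insertNew-front : ∀ a L → All (λ q → a < proj₁ q) L → insertNew a L ≡ (a , 1) ∷ L
insertNew-front a [] _ = refl
insertNew-front a (d ∷ L) (a<d ∷ _) with a <ᵇ proj₁ d | <ᵇ-reflects-< a (proj₁ d)
... | true | _ = refl
... | false | ofⁿ a≮d = ⊥-elim (a≮d a<d)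

insertNew-⊆ : ∀ a {L' L} → L' ⊆ L → Sorted L → insertNew a L' ⊆ insertNew a L
insertNew-⊆ a [] _ = refl ∷ []
insertNew-⊆ a {L'} {d ∷ L} (d ∷ʳ L'⊆L) (d≺L ∷ sL) with a <ᵇ proj₁ d | <ᵇ-reflects-< a (proj₁ d)
... | true | ofʸ a<d =
  subst (_⊆ (a , 1) ∷ d ∷ L)
    (sym (insertNew-front a L' (All.tabulate (λ q∈ → <-≤-trans a<d (≺⇒≤ (All.lookup d≺L (lookup L'⊆L q∈)))))))
    (refl ∷ (d ∷ʳ L'⊆L))
... | false | _ = d ∷ʳ insertNew-⊆ a L'⊆L sL
insertNew-⊆ a {d ∷ L'} {d ∷ L} (refl ∷ L'⊆L) (_ ∷ sL) with a <ᵇ proj₁ d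
... | true = refl ∷ refl ∷ L'⊆L
... | false = refl ∷ insertNew-⊆ a L'⊆L sL

burge-⊆ : ∀ {z x} → z ⊆ x →
  ∃[ e ] (e Preserves _<_ ⟶ _<_ × e 0 ≡ 0 × map (relabel e) (burge z) ⊆ burge x)
burge-⊆ [] = (λ i → i) , (λ i<j → i<j) , refl , []
burge-⊆ {z} {a ∷ x} (a ∷ʳ z⊆x) with e , e-mono , _ , sub ← burge-⊆ z⊆x =
  lift (e ∘ suc) , lift-strictlyMonotone (e-mono ∘ s≤s) , refl ,
  subst (_⊆ burge (a ∷ x)) (sym relabel≡)
    (⊆-trans (Sublist.map⁺ shift sub) (⊆-insertNew a (map shift (burge x))))
  where
  relabel≡ : map (relabel (lift (e ∘ suc))) (burge z) ≡ map shift (map (relabel e) (burge z))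
  relabel≡ = trans (List.map-cong-local (All.tabulate (positive ∘ columns-position≥ ∘ ∈-burge⇒∈-columns {z})))
                   (List.map-∘ (burge z))
    where
    positive : ∀ {p} → 1 ≤ proj₂ p → relabel (lift (e ∘ suc)) p ≡ shift (relabel e p)
    positive {_ , suc _} _ = refl
burge-⊆ {a ∷ z} {a ∷ x} (refl ∷ z⊆x) with e , e-mono , e0≡0 , sub ← burge-⊆ z⊆x =
  lift e , lift-strictlyMonotone e-mono , refl ,
  subst (_⊆ burge (a ∷ x)) (sym relabel≡)
    (insertNew-⊆ a (Sublist.map⁺ shift sub) (AllPairs.map⁺ (AllPairs.map ≺-shift (burge-sorted x))))
  where
  relabel≡ : map (relabel (lift e)) (burge (a ∷ z)) ≡ insertNew a (map shift (map (relabel e) (burge z)))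
  relabel≡ = trans (relabel-insertNew a (map shift (burge z)) (cong suc e0≡0))
                   (cong (insertNew a) (relabel-lift-shift e (burge z)))

γ-mono-≽ : ∀ {x y} → x ≽ y → γ x ≽ γ y
γ-mono-≽ {x} {y} (z , z⊆x , z≅y) with e , e-mono , _ , sub ← burge-⊆ z⊆x =
  map e (γ y) , subst₂ _⊆_ eγz≡ (sym (γ≡burge x)) (Sublist.map⁺ proj₂ sub) ,
  map-strictlyMonotone-orderIso e-mono (γ y)
  where
  eγz≡ : map proj₂ (map (relabel e) (burge z)) ≡ map e (γ y)
  eγz≡ = begin
    map proj₂ (map (relabel e) (burge z)) ≡⟨ List.map-∘ (burge z) ⟨
    map (e ∘ proj₂) (burge z)             ≡⟨ List.map-∘ (burge z) ⟩
    map e (map proj₂ (burge z))           ≡⟨ cong (map e) (trans (sym (γ≡burge z)) (orderIso⇒γ≡ z≅y)) ⟩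
    map e (γ y)                           ∎
    where open ≡-Reasoning

-- The size of a class

CoversFrom : ℕ → Word → Set
CoversFrom c v = All (c ≤_) v × (∀ k → c ≤ k → k ≤ maxW v → k ∈ v)

IsCayley⇔CoversFrom1 : ∀ {v} → IsCayley v ⇔ CoversFrom 1 v
IsCayley⇔CoversFrom1 = mk⇔ (λ (positive , covers) → All.tabulate (positive _) , covers)
                            (λ (positive , covers) → (λ _ → All.lookup positive) , covers)

≤maxW-∷ : ∀ {c k w} → c < k → k ≤ maxW (c ∷ w) → k ≤ maxW w
≤maxW-∷ {c} {k} {w} c<k k≤ with ≤-total c (maxW w)
... | inj₁ c≤max = subst (k ≤_) (m≤n⇒m⊔n≡n c≤max) k≤
... | inj₂ max≤c = ⊥-elim (<-irrefl refl (<-≤-trans c<k (subst (k ≤_) (m≥n⇒m⊔n≡m max≤c) k≤)))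

CoversFrom-∷⁺ : ∀ {c c' w} → c ≤ c' → c' ≤ suc c → CoversFrom c' w → CoversFrom c (c ∷ w)
CoversFrom-∷⁺ {c} {c'} {w} c≤c' c'≤1+c (c'≤w , covers) = ≤-refl ∷ All.map (≤-trans c≤c') c'≤w , covers'
  where
  covers' : ∀ k → c ≤ k → k ≤ maxW (c ∷ w) → k ∈ c ∷ w
  covers' k c≤k k≤ with c ≟ k
  ... | yes refl = here refl
  ... | no c≢k = let c<k = ≤∧≢⇒< c≤k c≢k in there (covers k (≤-trans c'≤1+c c<k) (≤maxW-∷ {w = w} c<k k≤))

CoversFrom-[] : ∀ c → CoversFrom (suc c) []
CoversFrom-[] c = [] , nothing-above
  where
  nothing-above : ∀ k → suc c ≤ k → k ≤ 0 → k ∈ []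
  nothing-above .zero () z≤n

CoversFrom-head : ∀ {a c w} → All (a ≤_) w → CoversFrom c (a ∷ w) → a ≡ c
CoversFrom-head {a} {c} {w} a≤w (c≤a ∷ _ , covers) with covers c ≤-refl (≤-trans c≤a (m≤m⊔n a (maxW w)))
... | here c≡a = sym c≡a
... | there c∈w = ≤-antisym (All.lookup a≤w c∈w) c≤a

CoversFrom-∷⁻-step : ∀ {c w} → All (suc c ≤_) w → CoversFrom c (c ∷ w) → CoversFrom (suc c) w
CoversFrom-∷⁻-step {c} {w} 1+c≤w (_ , covers) = 1+c≤w , covers'
  where
  covers' : ∀ k → suc c ≤ k → k ≤ maxW w → k ∈ w
  covers' k c<k k≤ with covers k (<⇒≤ c<k) (≤-trans k≤ (m≤n⊔m c (maxW w)))
  ... | here refl = ⊥-elim (<-irrefl refl c<k)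
  ... | there k∈w = k∈w

CoversFrom-∷⁻-same : ∀ {c w} → c ∈ w → CoversFrom c (c ∷ w) → CoversFrom c w
CoversFrom-∷⁻-same {c} {w} c∈w (_ ∷ c≤w , covers) = c≤w , covers'
  where
  covers' : ∀ k → c ≤ k → k ≤ maxW w → k ∈ w
  covers' k c≤k k≤ with covers k c≤k (≤-trans k≤ (m≤n⊔m c (maxW w)))
  ... | here refl = c∈w
  ... | there k∈w = k∈w

-- The top rows of the class of π, shifted to start at c: each step of such a row is +1,
-- or 0 at a descent of π.
valueWords : ℕ → Word → List Word
valueWords c [] = [] ∷ []
valueWords c (p ∷ []) = (c ∷ []) ∷ []
valueWords c (p ∷ q ∷ π) =
  map (c ∷_) (valueWords (suc c) (q ∷ π)) ++ (if q <ᵇ p then map (c ∷_) (valueWords c (q ∷ π)) else [])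

length-valueWords : ∀ c π → length (valueWords c π) ≡ 2 ^ des π
length-valueWords c [] = refl
length-valueWords c (p ∷ []) = refl
length-valueWords c (p ∷ q ∷ π) =
  length-branches (q <ᵇ p) {valueWords (suc c) (q ∷ π)} {valueWords c (q ∷ π)}
    (length-valueWords (suc c) (q ∷ π)) (length-valueWords c (q ∷ π))
  where
  length-branches : ∀ {m} b {up flat : List Word} → length up ≡ 2 ^ m → length flat ≡ 2 ^ m →
    length (map (c ∷_) up ++ (if b then map (c ∷_) flat else [])) ≡ 2 ^ ((if b then 1 else 0) + m)
  length-branches {m} true {up} {flat} |up| |flat| = begin
    length (map (c ∷_) up ++ map (c ∷_) flat)        ≡⟨ List.length-++ (map (c ∷_) up) ⟩
    length (map (c ∷_) up) + length (map (c ∷_) flat) ≡⟨ cong₂ _+_ (List.length-map _ up) (List.length-map _ flat) ⟩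
    length up + length flat                           ≡⟨ cong₂ _+_ |up| (trans |flat| (sym (+-identityʳ _))) ⟩
    2 ^ suc m                                         ∎
    where open ≡-Reasoning
  length-branches {m} false {up} |up| _ = begin
    length (map (c ∷_) up ++ [])  ≡⟨ cong length (List.++-identityʳ (map (c ∷_) up)) ⟩
    length (map (c ∷_) up)        ≡⟨ List.length-map (c ∷_) up ⟩
    length up                     ≡⟨ |up| ⟩
    2 ^ m                         ∎
    where open ≡-Reasoning

∈-valueWords⁻ : ∀ c p π {v} → v ∈ valueWords c (p ∷ π) →
  ∃[ w ] (v ≡ c ∷ w × length w ≡ length π × Linked _≺_ (zip v (p ∷ π)) × CoversFrom c v)
∈-valueWords⁻ c p [] (here refl) = [] , refl , refl , [-] , CoversFrom-∷⁺ (n≤1+n c) ≤-refl (CoversFrom-[] c)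
∈-valueWords⁻ c p (q ∷ π) v∈ with ∈-++⁻ (map (c ∷_) (valueWords (suc c) (q ∷ π))) v∈
... | inj₁ v∈up with u , u∈ , refl ← ∈-map⁻ (c ∷_) v∈up
                with w , refl , |w| , linked , covers ← ∈-valueWords⁻ (suc c) q π u∈ =
  u , refl , cong suc |w| , inj₁ ≤-refl ∷ linked , CoversFrom-∷⁺ (n≤1+n c) ≤-refl covers
... | inj₂ v∈flat with q <ᵇ p | <ᵇ-reflects-< q p
...   | true | ofʸ q<p with u , u∈ , refl ← ∈-map⁻ (c ∷_) v∈flat
                       with w , refl , |w| , linked , covers ← ∈-valueWords⁻ c q π u∈ =
  u , refl , cong suc |w| , inj₂ (refl , q<p) ∷ linked , CoversFrom-∷⁺ ≤-refl (n≤1+n c) covers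
...   | false | _ with () ← v∈flat

zip-heads≤ : ∀ {a p w π} → length w ≡ length π → All ((a , p) ≺_) (zip w π) → All (a ≤_) w
zip-heads≤ {w = []} {[]} _ _ = []
zip-heads≤ {w = _ ∷ _} {_ ∷ _} |w| (a≺b ∷ a≺w) = ≺⇒≤ a≺b ∷ zip-heads≤ (suc-injective |w|) a≺w

∈-valueWords⁺ : ∀ c π {v} → length v ≡ length π → Sorted (zip v π) → CoversFrom c v → v ∈ valueWords c π
∈-valueWords⁺ c [] {[]} _ _ _ = here refl
∈-valueWords⁺ c (p ∷ []) {a ∷ []} _ _ covers with refl ← CoversFrom-head [] covers = here refl
∈-valueWords⁺ c (p ∷ q ∷ π) {a ∷ b ∷ w} |v| ((a≺b ∷ a≺w) ∷ sorted) covers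
  with refl ← CoversFrom-head (zip-heads≤ (suc-injective |v|) (a≺b ∷ a≺w)) covers
  with a≺b
... | inj₁ a<b =
  let b≤w = zip-heads≤ (suc-injective (suc-injective |v|)) (AllPairs.head sorted)
      covers' = CoversFrom-∷⁻-step (a<b ∷ All.map (<-≤-trans a<b) b≤w) covers
  in ∈-++⁺ˡ (∈-map⁺ (a ∷_) (∈-valueWords⁺ (suc a) (q ∷ π) (suc-injective |v|) sorted covers'))
... | inj₂ (refl , q<p) with q <ᵇ p | <ᵇ-reflects-< q p
...   | true | _ = ∈-++⁺ʳ (map (a ∷_) (valueWords (suc a) (q ∷ π)))
          (∈-map⁺ (a ∷_) (∈-valueWords⁺ a (q ∷ π) (suc-injective |v|) sorted
            (CoversFrom-∷⁻-same (here refl) covers)))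
...   | false | ofⁿ q≮p = ⊥-elim (q≮p q<p)

valueWords-unique : ∀ c π → Unique (valueWords c π)
valueWords-unique c [] = [] ∷ []
valueWords-unique c (p ∷ []) = [] ∷ []
valueWords-unique c (p ∷ q ∷ π) =
  unique-branches (q <ᵇ p) (valueWords-unique (suc c) (q ∷ π)) (valueWords-unique c (q ∷ π))
  where
  up flat : List Word
  up = valueWords (suc c) (q ∷ π)
  flat = valueWords c (q ∷ π)
  disjoint : Disjoint (map (c ∷_) up) (map (c ∷_) flat)
  disjoint (v∈up , v∈flat)
    with _ , u₁∈ , refl ← ∈-map⁻ (c ∷_) v∈up | _ , u₂∈ , u₁≡u₂ ← ∈-map⁻ (c ∷_) v∈flat
    with _ , refl , _ ← ∈-valueWords⁻ (suc c) q π u₁∈ | _ , refl , _ ← ∈-valueWords⁻ c q π u₂∈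
    = 1+n≢n (List.∷-injectiveˡ (List.∷-injectiveʳ u₁≡u₂))
  unique-branches : ∀ b → Unique up → Unique flat → Unique (map (c ∷_) up ++ (if b then map (c ∷_) flat else []))
  unique-branches true u-up u-flat =
    Unique.++⁺ (Unique.map⁺ List.∷-injectiveʳ u-up) (Unique.map⁺ List.∷-injectiveʳ u-flat) disjoint
  unique-branches false u-up _ = subst Unique (sym (List.++-identityʳ _)) (Unique.map⁺ List.∷-injectiveʳ u-up)

∈-valueWords₁⁻ : ∀ π {v} → v ∈ valueWords 1 π → length v ≡ length π × Sorted (zip v π) × IsCayley v
∈-valueWords₁⁻ [] (here refl) = refl , [] , from IsCayley⇔CoversFrom1 (CoversFrom-[] 0)
∈-valueWords₁⁻ (p ∷ π) v∈ with _ , refl , |w| , linked , covers ← ∈-valueWords⁻ 1 p π v∈ =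
  cong suc |w| , Linked⇒AllPairs ≺-trans linked , from IsCayley⇔CoversFrom1 covers

module _ {n π} (π↭id : IsPerm n π) where

  class : List Word
  class = map (λ v → unγ v π) (valueWords 1 π)

  class-unique : Unique class
  class-unique = map⁺-injectiveOn (λ v → unγ v π) (valueWords-unique 1 π) injective
    where
    injective : ∀ {v w} → v ∈ valueWords 1 π → w ∈ valueWords 1 π → unγ v π ≡ unγ w π → v ≡ w
    injective v∈ w∈ eq with |v| , v-sorted , _ ← ∈-valueWords₁⁻ π v∈
                         | |w| , w-sorted , _ ← ∈-valueWords₁⁻ π w∈ =
      trans (sym (topRow-unγ π↭id (trans |v| |π|) v-sorted))
        (trans (cong topRow eq) (topRow-unγ π↭id (trans |w| |π|) w-sorted))
      where
      |π| : length π ≡ n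
      |π| = IsPerm⇒length π↭id

  ∈-class⇔ : ∀ {x} → x ∈ class ⇔ (CayN n x × γ x ≡ π)
  ∈-class⇔ {x} = mk⇔ to-class from-class
    where
    to-class : x ∈ class → CayN n x × γ x ≡ π
    to-class x∈ with v , v∈ , refl ← ∈-map⁻ _ x∈ with |v| , v-sorted , v-cayley ← ∈-valueWords₁⁻ π v∈ =
      let |v|≡n = trans |v| (IsPerm⇒length π↭id) in
      (length-unγ π↭id |v|≡n v-sorted , IsCayley-resp-↭ (↭-sym (unγ-↭ π↭id |v|≡n v-sorted)) v-cayley) ,
      γ-unγ π↭id |v|≡n v-sorted
    from-class : CayN n x × γ x ≡ π → x ∈ class
    from-class ((|x| , x-cayley) , refl) =
      subst (_∈ class) (unγ-topRow-γ x) (∈-map⁺ (λ v → unγ v (γ x)) (∈-valueWords⁺ 1 (γ x)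
        (trans (Perm.↭-length (topRow-↭ x)) (sym (length-γ x)))
        (subst Sorted (sym (zip-map-proj (burgeT (biword x)))) (burgeT-biword-sorted x))
        (to IsCayley⇔CoversFrom1 (IsCayley-resp-↭ (↭-sym (topRow-↭ x)) x-cayley))))

classSize≡2^des : ∀ {n C r} → Unique C → (∀ x → (x ∈ C) ⇔ CayN n x) → CayN n r →
  classSize C r ≡ 2 ^ des (γ r)
classSize≡2^des {n} {C} {r} uC C≈Cay (|r| , _) = begin
  length (filter sameClass? C)  ≡⟨ Perm.↭-length filter↭class ⟩
  length (class π↭id)           ≡⟨ List.length-map _ (valueWords 1 (γ r)) ⟩
  length (valueWords 1 (γ r))   ≡⟨ length-valueWords 1 (γ r) ⟩
  2 ^ des (γ r)                 ∎
  where
  open ≡-Reasoning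
  sameClass? : ∀ x → Dec (γ x ≡ γ r)
  sameClass? x = γ x ≟W γ r
  π↭id : IsPerm n (γ r)
  π↭id = subst (λ m → IsPerm m (γ r)) |r| (γ-IsPerm r)
  filter≈class : filter sameClass? C ∼[ set ] class π↭id
  filter≈class = mk⇔
    (λ x∈ → let x∈C , γx≡γr = ∈-filter⁻ sameClass? x∈
            in from (∈-class⇔ π↭id) (to (C≈Cay _) x∈C , γx≡γr))
    (λ x∈ → let x-cay , γx≡γr = to (∈-class⇔ π↭id) x∈
            in ∈-filter⁺ sameClass? (from (C≈Cay _) x-cay) γx≡γr)
  filter↭class : filter sameClass? C ↭ class π↭id
  filter↭class = unique-↭ (Unique.filter⁺ sameClass? uC) (class-unique π↭id) filter≈class

-- Avoidance

module _ {k σ} (σ↭id : IsPerm k σ) where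

  γ≽⇒≽C-inverse : ∀ {r} → γ r ≽ σ → r ≽C inverse σ
  γ≽⇒≽C-inverse {r} γr≽σ =
    γ (γ r) , γ σ , IsPerm⇒IsCayley (γ-IsPerm (γ r)) , IsPerm⇒IsCayley (γ-IsPerm σ) ,
    γ-involutive (γ-IsPerm r) , cong γ (sym (inverse≡γ σ↭id)) , γ-mono-≽ γr≽σ

  γ≽C-inverse⇒≽ : ∀ {n π} → IsPerm n π → γ π ≽C inverse σ → π ≽ σ
  γ≽C-inverse⇒≽ π↭id (x , y , _ , _ , γx≡γγπ , γy≡γσ⁻¹ , x≽y) = subst₂ _≽_
    (trans γx≡γγπ (γ-involutive π↭id))
    (trans γy≡γσ⁻¹ (trans (cong γ (inverse≡γ σ↭id)) (γ-involutive σ↭id)))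
    (γ-mono-≽ x≽y)

countClass-∷-self : ∀ r R → countClass (r ∷ R) r ≡ suc (countClass R r)
countClass-∷-self r R = cong length (List.filter-accept (λ s → γ s ≟W γ r) {r} {R} refl)

∈⇒countClass-pos : ∀ {R r y} → r ∈ R → γ r ≡ γ y → 0 < countClass R y
∈⇒countClass-pos {y = y} r∈ γr≡γy = ∈⇒length-pos (∈-filter⁺ (λ s → γ s ≟W γ y) r∈ γr≡γy)
  where
  ∈⇒length-pos : ∀ {A : Set} {a : A} {xs} → a ∈ xs → 0 < length xs
  ∈⇒length-pos {xs = _ ∷ _} _ = z<s

countClass-pos⇒∈ : ∀ R {y} → 0 < countClass R y → ∃[ r ] (r ∈ R × γ r ≡ γ y)
countClass-pos⇒∈ R {y} pos with filter (λ s → γ s ≟W γ y) R in eq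
... | r ∷ _ = r , ∈-filter⁻ (λ s → γ s ≟W γ y) (subst (r ∈_) (sym eq) (here refl))

countClass≡1⇒Unique : ∀ R → (∀ r → r ∈ R → countClass R r ≡ 1) → Unique (map γ R)
countClass≡1⇒Unique [] _ = []
countClass≡1⇒Unique (r ∷ R) count≡1 =
  All.tabulate γr∉ ∷ countClass≡1⇒Unique R (λ r' r'∈ → count≡1-tail r'∈)
  where
  count-r≡0 : countClass R r ≡ 0
  count-r≡0 = suc-injective (trans (sym (countClass-∷-self r R)) (count≡1 r (here refl)))
  γr≢ : ∀ {r'} → r' ∈ R → γ r ≢ γ r'
  γr≢ {r'} r'∈ γr≡γr' = <-irrefl (sym count-r≡0) (∈⇒countClass-pos {R} {r'} {r} r'∈ (sym γr≡γr'))
  γr∉ : ∀ {π} → π ∈ map γ R → γ r ≢ π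
  γr∉ π∈ with _ , r'∈ , refl ← ∈-map⁻ γ π∈ = γr≢ r'∈
  count≡1-tail : ∀ {r'} → r' ∈ R → countClass R r' ≡ 1
  count≡1-tail {r'} r'∈ =
    trans (sym (cong length (List.filter-reject (λ s → γ s ≟W γ r') {r} {R} (γr≢ r'∈))))
      (count≡1 r' (there r'∈))

map-γ-↭ : ∀ {n k σ P R} → IsPerm k σ → Unique P → (∀ π → (π ∈ P) ⇔ (IsPerm n π × ¬ (π ≽ σ))) →
  (∀ r → r ∈ R → CayN n r × ¬ (r ≽C inverse σ)) →
  (∀ y → CayN n y → ¬ (y ≽C inverse σ) → countClass R y ≡ 1) → map γ R ↭ P
map-γ-↭ {n} {σ = σ} {P} {R} σ↭id uP P≈ R⊆ count≡1 =
  unique-↭ (countClass≡1⇒Unique R (λ r r∈ → count≡1 r (proj₁ (R⊆ r r∈)) (proj₂ (R⊆ r r∈))))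
    uP (mk⇔ γ[R]⊆P P⊆γ[R])
  where
  γ[R]⊆P : ∀ {π} → π ∈ map γ R → π ∈ P
  γ[R]⊆P π∈ with r , r∈ , refl ← ∈-map⁻ γ π∈ with (|r| , _) , r-avoids ← R⊆ r r∈ =
    from (P≈ (γ r)) (subst (λ m → IsPerm m (γ r)) |r| (γ-IsPerm r) , r-avoids ∘ γ≽⇒≽C-inverse σ↭id {r})
  P⊆γ[R] : ∀ {π} → π ∈ P → π ∈ map γ R
  P⊆γ[R] {π} π∈ with π↭id , π-avoids ← to (P≈ π) π∈
    with count≡1-γπ ← count≡1 (γ π) (γ-CayN π↭id) (π-avoids ∘ γ≽C-inverse⇒≽ σ↭id π↭id)
    with r , r∈ , γr≡γγπ ← countClass-pos⇒∈ R {γ π} (subst (0 <_) (sym count≡1-γπ) z<s) =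
    subst (_∈ map γ R) (trans γr≡γγπ (γ-involutive π↭id)) (∈-map⁺ γ r∈)

mainTheorem16 : (n k : ℕ) (σ : Word) → IsPerm k σ →
    (P : List Word) → Unique P → (∀ π → (π ∈ P) ⇔ (IsPerm n π × ¬ (π ≽ σ))) →
    (C : List Word) → Unique C → (∀ x → (x ∈ C) ⇔ CayN n x) →
    (R : List Word) → (∀ r → r ∈ R → CayN n r × ¬ (r ≽C inverse σ)) →
    (∀ y → CayN n y → ¬ (y ≽C inverse σ) → countClass R y ≡ 1) →
    (t : ℕ) →
    sum (map (λ π → t ^ des π) P) ≡ sum (map (λ r → t ^ ⌊log₂ classSize C r ⌋) R)
mainTheorem16 n k σ σ↭id P uP P≈ C uC C≈Cay R R⊆ count≡1 t = begin
  sum (map (λ π → t ^ des π) P)                  ≡⟨ sum-↭ (Perm.map⁺ (λ π → t ^ des π) (map-γ-↭ σ↭id uP P≈ R⊆ count≡1)) ⟨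
  sum (map (λ π → t ^ des π) (map γ R))          ≡⟨ cong sum (List.map-∘ R) ⟨
  sum (map (λ r → t ^ des (γ r)) R)              ≡⟨ cong sum (List.map-cong-local (All.tabulate (cong (t ^_) ∘ des≡log))) ⟩
  sum (map (λ r → t ^ ⌊log₂ classSize C r ⌋) R)  ∎
  where
  open ≡-Reasoning
  des≡log : ∀ {r} → r ∈ R → des (γ r) ≡ ⌊log₂ classSize C r ⌋
  des≡log {r} r∈ = sym (begin
    ⌊log₂ classSize C r ⌋  ≡⟨ cong ⌊log₂_⌋ (classSize≡2^des uC C≈Cay (proj₁ (R⊆ r r∈))) ⟩
    ⌊log₂ 2 ^ des (γ r) ⌋  ≡⟨ ⌊log₂[2^n]⌋≡n (des (γ r)) ⟩
    des (γ r)              ∎)
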